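{- Let $\mathcal{F}$ be a family of integer intervals of $\{1,\ldots,n\}$ that is closed under intersection and contains every singleton, and let $(potBeg,potEnd)$ be a couple of potentiality for $\mathcal{F}$. For each $y\in\{1,\ldots,n\}$, the set $B(y)=\{x : [x,y]\in\mathcal{F}\}$ of beginnings of members of $\mathcal{F}$ ending at $y$ equals $potBeg(y)\cap[LSplitter[y]+1,\,y]$; in particular $B(y)$ is a suffix of $potBeg(y)$, i.e. if $x\in B(y)$, $x'\in potBeg(y)$ and $x\le x'$, then $x'\in B(y)$.
   Context: Closed under intersection means: if $I_1,I_2\in\mathcal{F}$ and $I_1\cap I_2\neq\emptyset$ then $I_1\cap I_2\in\mathcal{F}$. A couple of potentiality for $\mathcal{F}$ is a pair of maps $potBeg,potEnd$ from $\{1,\ldots,n\}$ to subsets of $\{1,\ldots,n\}$ such that: $potBeg(y)\subseteq\{1,\ldots,y\}$ and $potEnd(x)\subseteq\{x,\ldots,n\}$ for all $x,y$; $potBeg(y)\subseteq potBeg(y-1)\cup\{y\}$ for all $2\le y\le n$; $potEnd(x)\subseteq potEnd(x+1)\cup\{x\}$ for all $1\le x\le n-1$; and for all $1\le x\le y\le n$, $[x,y]\in\mathcal{F}$ iff ($x\in potBeg(y)$ and $y\in potEnd(x)$). The left-splitter $LSplitter[y]$ is the maximum $x<y$ with $y\notin potEnd(x)$ ($-\infty$ if none). -}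

module Defs where

open import Data.Nat using (ℕ; zero; suc; _≤_; _<_; _⊔_; _⊓_; _∸_)
open import Data.Bool using (Bool; true; false; if_then_else_)
open import Data.Maybe using (Maybe; just; nothing)
open import Data.Product using (_×_)
open import Data.Unit using (⊤)
open import Data.Sum using (_⊎_)
open import Relation.Binary.PropositionalEquality using (_≡_)

-- A family of intervals F : F x y ≡ true  means  [x,y] ∈ F.
-- potBeg y x ≡ true  means  x ∈ potBeg(y);  potEnd x y ≡ true  means  y ∈ potEnd(x).

IntervalFamily : ℕ → (ℕ → ℕ → Bool) → Set
IntervalFamily n F = ∀ x y → F x y ≡ true → 1 ≤ x × x ≤ y × y ≤ n

-- closed under (nonempty) intersection: [x1,y1] ∩ [x2,y2] = [x1 ⊔ x2, y1 ⊓ y2]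
ClosedUnderIntersection : (ℕ → ℕ → Bool) → Set
ClosedUnderIntersection F =
  ∀ x₁ y₁ x₂ y₂ → F x₁ y₁ ≡ true → F x₂ y₂ ≡ true →
  x₁ ⊔ x₂ ≤ y₁ ⊓ y₂ → F (x₁ ⊔ x₂) (y₁ ⊓ y₂) ≡ true

ContainsSingletons : ℕ → (ℕ → ℕ → Bool) → Set
ContainsSingletons n F = ∀ x → 1 ≤ x → x ≤ n → F x x ≡ true

record Potentiality (n : ℕ) (F : ℕ → ℕ → Bool)
                    (potBeg potEnd : ℕ → ℕ → Bool) : Set where
  field
    begRange : ∀ y x → 1 ≤ y → y ≤ n → potBeg y x ≡ true → 1 ≤ x × x ≤ y
    endRange : ∀ x y → 1 ≤ x → x ≤ n → potEnd x y ≡ true → x ≤ y × y ≤ n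
    begStep  : ∀ y x → 2 ≤ y → y ≤ n → potBeg y x ≡ true →
               potBeg (y ∸ 1) x ≡ true ⊎ x ≡ y
    endStep  : ∀ x y → 1 ≤ x → x ≤ n ∸ 1 → potEnd x y ≡ true →
               potEnd (suc x) y ≡ true ⊎ y ≡ x
    charact  : ∀ x y → 1 ≤ x → x ≤ y → y ≤ n →
               (F x y ≡ true → potBeg y x ≡ true × potEnd x y ≡ true) ×
               (potBeg y x ≡ true × potEnd x y ≡ true → F x y ≡ true)

-- LSplitter[y] = max { x : 1 ≤ x < y, y ∉ potEnd(x) }, or nothing (= -∞) if none.
-- Computed by downward search x = y-1, y-2, …, 1.
LSplitterFrom : (ℕ → ℕ → Bool) → ℕ → ℕ → Maybe ℕ
LSplitterFrom potEnd y zero    = nothing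
LSplitterFrom potEnd y (suc k) =
  if potEnd (suc k) y then LSplitterFrom potEnd y k else just (suc k)

LSplitter : (ℕ → ℕ → Bool) → ℕ → Maybe ℕ
LSplitter potEnd y = LSplitterFrom potEnd y (y ∸ 1)

-- "LSplitter[y] + 1 ≤ x", with -∞ + 1 ≤ x always true
_<ₘ_ : Maybe ℕ → ℕ → Set
nothing <ₘ x = ⊤
just s  <ₘ x = s < x

module Submission where

open import Defs
open import Data.Nat using (ℕ; zero; suc; _≤_; _<_; _≤′_; ≤′-refl; ≤′-step; _∸_; _≤?_; s≤s)
open import Data.Nat.Properties
  using (≤-refl; ≤-trans; <-≤-trans; n≤1+n; ≰⇒>; <⇒≱; 1+n≰n; ∸-monoˡ-≤; m∸n≤m; m≤n⇒m<n∨m≡n; ≤⇒≤′; ≤′⇒≤)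
open import Data.Bool using (Bool; true; false)
open import Data.Maybe using (Maybe; just; nothing)
open import Data.Product using (_×_; _,_; proj₁; proj₂)
open import Data.Sum using (inj₁; inj₂)
open import Data.Unit using (tt)
open import Data.Empty using (⊥-elim)
open import Relation.Nullary using (yes; no)
open import Relation.Binary.PropositionalEquality using (_≡_; refl; sym; trans)

-- By the step axiom on potEnd, y ∈ potEnd(x) propagates from x up to y, so the
-- x < y with y ∈ potEnd(x) form the block ]LSplitter[y], y[. For [x,y] ∈ F the
-- characterisation of F puts x in potBeg(y) and in that block; conversely, on that
-- block the characterisation gives [x,y] ∈ F, and x = y is a singleton.

<ₘ-≤-trans : ∀ {a b} (m : Maybe ℕ) → m <ₘ a → a ≤ b → m <ₘ b
<ₘ-≤-trans nothing  _   _   = tt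
<ₘ-≤-trans (just s) s<a a≤b = <-≤-trans s<a a≤b

module _ (potEnd : ℕ → ℕ → Bool) (y : ℕ) where

  all-potEnd⇒LSplitterFrom-<ₘ : ∀ {x} k → (∀ z → x ≤ z → z ≤ k → potEnd z y ≡ true) →
                                LSplitterFrom potEnd y k <ₘ x
  all-potEnd⇒LSplitterFrom-<ₘ zero    _   = tt
  all-potEnd⇒LSplitterFrom-<ₘ {x} (suc k) all with potEnd (suc k) y in eq
  ... | true  = all-potEnd⇒LSplitterFrom-<ₘ k (λ z x≤z z≤k → all z x≤z (≤-trans z≤k (n≤1+n k)))
  ... | false with x ≤? suc k
  ...   | yes x≤k+1 with () ← trans (sym eq) (all (suc k) x≤k+1 ≤-refl)
  ...   | no  x≰k+1 = ≰⇒> x≰k+1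

  LSplitterFrom-<ₘ⇒potEnd : ∀ {x} k → 1 ≤ x → x ≤ k → LSplitterFrom potEnd y k <ₘ x →
                            potEnd x y ≡ true
  LSplitterFrom-<ₘ⇒potEnd zero    (s≤s _) () _
  LSplitterFrom-<ₘ⇒potEnd (suc k) 1≤x x≤k+1 split<x with potEnd (suc k) y in eq
  ... | false = ⊥-elim (<⇒≱ split<x x≤k+1)
  ... | true with m≤n⇒m<n∨m≡n x≤k+1
  ...   | inj₂ refl    = eq
  ...   | inj₁ (s≤s x≤k) = LSplitterFrom-<ₘ⇒potEnd k 1≤x x≤k split<x

module PotentialityProperties {n : ℕ} {F potBeg potEnd : ℕ → ℕ → Bool}
                              (P : Potentiality n F potBeg potEnd) where
  open Potentiality P

  potEnd-suc : ∀ {z y} → 1 ≤ z → z < y → y ≤ n → potEnd z y ≡ true → potEnd (suc z) y ≡ true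
  potEnd-suc 1≤z z<y y≤n y∈potEnd[z] with endStep _ _ 1≤z (∸-monoˡ-≤ 1 (≤-trans z<y y≤n)) y∈potEnd[z]
  ... | inj₁ y∈potEnd[z+1] = y∈potEnd[z+1]
  ... | inj₂ refl          = ⊥-elim (1+n≰n z<y)

  potEnd-upward : ∀ {x z y} → 1 ≤ x → x ≤′ z → z ≤ y → y ≤ n →
                  potEnd x y ≡ true → potEnd z y ≡ true
  potEnd-upward 1≤x ≤′-refl        _   _   y∈potEnd[x] = y∈potEnd[x]
  potEnd-upward 1≤x (≤′-step x≤′z) z≤y y≤n y∈potEnd[x] =
    potEnd-suc (≤-trans 1≤x (≤′⇒≤ x≤′z)) z≤y y≤n
      (potEnd-upward 1≤x x≤′z (≤-trans (n≤1+n _) z≤y) y≤n y∈potEnd[x])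

  module Beginnings (intervals : IntervalFamily n F) (singletons : ContainsSingletons n F)
           {y : ℕ} (1≤y : 1 ≤ y) (y≤n : y ≤ n) where

    beginning⇒potBeg∧LSplitter : ∀ x → F x y ≡ true →
                                 potBeg y x ≡ true × LSplitter potEnd y <ₘ x × x ≤ y
    beginning⇒potBeg∧LSplitter x [x,y]∈F with intervals x y [x,y]∈F
    ... | 1≤x , x≤y , _ with proj₁ (charact x y 1≤x x≤y y≤n) [x,y]∈F
    ...   | x∈potBeg[y] , y∈potEnd[x] =
      x∈potBeg[y] , all-potEnd⇒LSplitterFrom-<ₘ potEnd y (y ∸ 1) y∈potEnd[z] , x≤y
      where
      y∈potEnd[z] : ∀ z → x ≤ z → z ≤ y ∸ 1 → potEnd z y ≡ true
      y∈potEnd[z] z x≤z z≤y-1 =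
        potEnd-upward 1≤x (≤⇒≤′ x≤z) (≤-trans z≤y-1 (m∸n≤m y 1)) y≤n y∈potEnd[x]

    potBeg∧LSplitter⇒beginning : ∀ x → potBeg y x ≡ true × LSplitter potEnd y <ₘ x × x ≤ y →
                                 F x y ≡ true
    potBeg∧LSplitter⇒beginning x (x∈potBeg[y] , split<x , x≤y)
      with 1≤x , _ ← begRange y x 1≤y y≤n x∈potBeg[y]
      with m≤n⇒m<n∨m≡n x≤y
    ... | inj₂ refl = singletons x 1≤x y≤n
    ... | inj₁ x<y  = proj₂ (charact x y 1≤x x≤y y≤n)
      (x∈potBeg[y] , LSplitterFrom-<ₘ⇒potEnd potEnd y (y ∸ 1) 1≤x (∸-monoˡ-≤ 1 x<y) split<x)

    beginnings-suffix : ∀ x x′ → F x y ≡ true → potBeg y x′ ≡ true → x ≤ x′ → F x′ y ≡ true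
    beginnings-suffix x x′ [x,y]∈F x′∈potBeg[y] x≤x′ =
      potBeg∧LSplitter⇒beginning x′
        (x′∈potBeg[y] , <ₘ-≤-trans (LSplitter potEnd y) split<x x≤x′ , x′≤y)
      where
      split<x : LSplitter potEnd y <ₘ x
      split<x = proj₁ (proj₂ (beginning⇒potBeg∧LSplitter x [x,y]∈F))
      x′≤y : x′ ≤ y
      x′≤y = proj₂ (begRange y x′ 1≤y y≤n x′∈potBeg[y])

mainTheorem4 :
    (n : ℕ) (F : ℕ → ℕ → Bool) (potBeg potEnd : ℕ → ℕ → Bool) →
    IntervalFamily n F →
    ClosedUnderIntersection F →
    ContainsSingletons n F →
    Potentiality n F potBeg potEnd →
    (y : ℕ) → 1 ≤ y → y ≤ n →
    ((x : ℕ) →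
      (F x y ≡ true →
        potBeg y x ≡ true × LSplitter potEnd y <ₘ x × x ≤ y) ×
      (potBeg y x ≡ true × LSplitter potEnd y <ₘ x × x ≤ y →
        F x y ≡ true)) ×
    ((x x′ : ℕ) → F x y ≡ true → potBeg y x′ ≡ true → x ≤ x′ →
      F x′ y ≡ true)
mainTheorem4 n F potBeg potEnd intervals _ singletons P y 1≤y y≤n =
  (λ x → beginning⇒potBeg∧LSplitter x , potBeg∧LSplitter⇒beginning x) , beginnings-suffix
  where open PotentialityProperties.Beginnings P intervals singletons 1≤y y≤n
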